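{- For every $a, b \in \Lambda_{\mathrm{dB}}$, $a\{\!\{1 \leftarrow b\}\!\} = a[b]$. Consequently the reduction relations $\to_{\beta_{\mathrm{dB}}}$ and $\to_{\beta_r}$ on $\Lambda_{\mathrm{dB}}$ coincide, i.e. the $\lambda_{\mathrm{dB}}$-calculus and the $\lambda r$-calculus are the same calculus.
   Context: $\Lambda_{\mathrm{dB}}$ is the set of de Bruijn terms given by $a ::= n \mid a\,a \mid \lambda a$ with $n \in \mathbb{N}_{>0}$. Updating: for $k\in\mathbb{N}$, $i\in\mathbb{N}_{>0}$, $U^i_k(n)=n$ if $n\le k$ and $U^i_k(n)=n+i-1$ if $n>k$; $U^i_k(a\,b)=U^i_k(a)\,U^i_k(b)$; $U^i_k(\lambda a)=\lambda U^i_{k+1}(a)$. de Bruijn meta-substitution: $m\{\!\{n\leftarrow c\}\!\}$ equals $m$ if $m<n$, $U^n_0(c)$ if $m=n$, and $m-1$ if $m>n$; $(a\,b)\{\!\{n\leftarrow c\}\!\}=a\{\!\{n\leftarrow c\}\!\}\,b\{\!\{n\leftarrow c\}\!\}$; $(\lambda a)\{\!\{n\leftarrow c\}\!\}=\lambda\,(a\{\!\{n+1\leftarrow c\}\!\})$. Increment: for $i\in\mathbb{N}$, $\mathrm{inc}_i(n)=n$ if $n\le i$ and $n+1$ if $n>i$; $\mathrm{inc}_i(a\,b)=\mathrm{inc}_i(a)\,\mathrm{inc}_i(b)$; $\mathrm{inc}_i(\lambda a)=\lambda\,\mathrm{inc}_{i+1}(a)$. Swap: for $i\in\mathbb{N}_{>0}$,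 $\mathrm{sw}_i(n)=n$ if $n<i$ or $n>i+1$, $\mathrm{sw}_i(i)=i+1$, $\mathrm{sw}_i(i+1)=i$; $\mathrm{sw}_i(a\,b)=\mathrm{sw}_i(a)\,\mathrm{sw}_i(b)$; $\mathrm{sw}_i(\lambda a)=\lambda\,\mathrm{sw}_{i+1}(a)$. $\lambda r$ meta-substitution $a[c]$: $1[c]=c$, $n[c]=n-1$ for $n>1$; $(a\,b)[c]=a[c]\,b[c]$; $(\lambda a)[c]=\lambda\big(\mathrm{sw}_1(a)[\mathrm{inc}_0(c)]\big)$. $a \to_{\beta_{\mathrm{dB}}} b$ iff there exist a context $C$ and terms $c,d$ with $a=C[(\lambda c)\,d]$ and $b=C[c\{\!\{1\leftarrow d\}\!\}]$. $a\to_{\beta_r} b$ iff there exist a context $C$ and terms $c,d$ with $a=C[(\lambda c)\,d]$ and $b=C[c[d]]$. The $\lambda_{\mathrm{dB}}$-calculus is $(\Lambda_{\mathrm{dB}},\beta_{\mathrm{dB}})$ and the $\lambda r$-calculus is $(\Lambda_{\mathrm{dB}},\beta_r)$. -}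

module Defs where

open import Data.Nat using (ℕ; zero; suc; _+_; _∸_; _≤_; _<_; _≤ᵇ_; _<ᵇ_; _≡ᵇ_)
open import Data.Bool using (Bool; true; false; if_then_else_)

-- Encoding: the index n ≥ 1 is represented as  ` k  with  n = suc k,
-- i.e.  ` : ℕ → Term  and  (` k) stands for the de Bruijn index (suc k).
-- idx gives the positive index a variable stands for.
data Term : Set where
  `_  : ℕ → Term
  _·_ : Term → Term → Term
  ƛ_  : Term → Term

infixl 7 _·_
infix  9 `_
infix  5 ƛ_

U : ℕ → ℕ → Term → Term
U i k (` m)   = if suc m ≤ᵇ k then ` m else ` (m + i ∸ 1)
U i k (a · b) = U i k a · U i k b
U i k (ƛ a)   = ƛ U i (suc k) a

_⟦_←_⟧ : Term → ℕ → Term → Term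
(` m)   ⟦ n ← c ⟧ = if suc m <ᵇ n then ` m
                     else if suc m ≡ᵇ n then U n 0 c
                     else ` (m ∸ 1)
(a · b) ⟦ n ← c ⟧ = (a ⟦ n ← c ⟧) · (b ⟦ n ← c ⟧)
(ƛ a)   ⟦ n ← c ⟧ = ƛ (a ⟦ suc n ← c ⟧)

inc : ℕ → Term → Term
inc i (` m)   = if suc m ≤ᵇ i then ` m else ` (suc m)
inc i (a · b) = inc i a · inc i b
inc i (ƛ a)   = ƛ inc (suc i) a

sw : ℕ → Term → Term
sw i (` m)   = if suc m ≡ᵇ i then ` (suc m)
               else if suc m ≡ᵇ suc i then ` (m ∸ 1)
               else ` m
sw i (a · b) = sw i a · sw i b
sw i (ƛ a)   = ƛ sw (suc i) a

-- The defining clause (λa)[c] = λ(sw_1(a)[inc_0(c)]) is not structurally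
-- recursive, so we recurse on a fuel argument equal to the term size
-- (sw preserves size, so fuel size(a) always suffices and the fuel-out
-- clause is never reached from  _[_] ).
size : Term → ℕ
size (` m)   = 1
size (a · b) = suc (size a + size b)
size (ƛ a)   = suc (size a)

subr : ℕ → Term → Term → Term
subr zero    a           c = a
subr (suc f) (` zero)    c = c
subr (suc f) (` (suc m)) c = ` m
subr (suc f) (a · b)     c = subr f a c · subr f b c
subr (suc f) (ƛ a)       c = ƛ subr f (sw 1 a) (inc 0 c)

_[_] : Term → Term → Term
a [ c ] = subr (size a) a c

data Ctx : Set where
  □    : Ctx
  _·ₗ_ : Ctx → Term → Ctx
  _·ᵣ_ : Term → Ctx → Ctx
  ƛ□_  : Ctx → Ctx

plug : Ctx → Term → Term
plug □        t = t
plug (C ·ₗ b) t = plug C t · b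
plug (a ·ᵣ C) t = a · plug C t
plug (ƛ□ C)   t = ƛ plug C t

data _→βdB_ : Term → Term → Set where
  βdB : ∀ C c d → plug C ((ƛ c) · d) →βdB plug C (c ⟦ 1 ← d ⟧)

data _→βr_ : Term → Term → Set where
  βr : ∀ C c d → plug C ((ƛ c) · d) →βr plug C (c [ d ])

-- a {{k+1 ← c}} is the λr-substitution of U^{k+1}_0(c) into a with its indices
-- 1, …, k + 1 rotated so that k + 1 comes first.  This generalisation is closed
-- under binders: the swap sw₁ that λr performs under a λ composes with the
-- rotation of the body into the rotation of one more index, and
-- inc₀ ∘ U^{k+1}_0 = U^{k+2}_0.  For k = 0 the rotation and the updating are
-- identities.
module Submission where

open import Defs
open import Data.Bool using (true; false; if_then_else_)
open import Data.Empty using (⊥-elim)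
open import Data.Nat using (ℕ; suc; _+_; _≤_; _<_; _≤ᵇ_; _<ᵇ_; _≡ᵇ_; z≤n; z<s; s≤s)
open import Data.Nat.Properties
open import Data.Product using (_×_; _,_)
open import Relation.Binary.Definitions using (tri<; tri≈; tri>)
open import Relation.Binary.PropositionalEquality
  using (_≡_; _≢_; refl; sym; cong; cong₂; subst; module ≡-Reasoning)
open import Relation.Nullary using (¬_; yes; no)
open import Relation.Nullary.Reflects using (Reflects; ofʸ; ofⁿ; fromEquivalence)

reflects-true : ∀ {a} {P : Set a} {b} → Reflects P b → P → b ≡ true
reflects-true (ofʸ _)  _ = refl
reflects-true (ofⁿ ¬p) p = ⊥-elim (¬p p)

reflects-false : ∀ {a} {P : Set a} {b} → Reflects P b → ¬ P → b ≡ false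
reflects-false (ofʸ p) ¬p = ⊥-elim (¬p p)
reflects-false (ofⁿ _) _  = refl

≤ᵇ-true : ∀ {m n} → m ≤ n → (m ≤ᵇ n) ≡ true
≤ᵇ-true {m} {n} = reflects-true (≤ᵇ-reflects-≤ m n)

≤ᵇ-false : ∀ {m n} → n < m → (m ≤ᵇ n) ≡ false
≤ᵇ-false {m} {n} n<m = reflects-false (≤ᵇ-reflects-≤ m n) (<⇒≱ n<m)

<ᵇ-true : ∀ {m n} → m < n → (m <ᵇ n) ≡ true
<ᵇ-true {m} {n} = reflects-true (<ᵇ-reflects-< m n)

<ᵇ-false : ∀ {m n} → n ≤ m → (m <ᵇ n) ≡ false
<ᵇ-false {m} {n} n≤m = reflects-false (<ᵇ-reflects-< m n) (≤⇒≯ n≤m)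

≡ᵇ-reflects-≡ : ∀ m n → Reflects (m ≡ n) (m ≡ᵇ n)
≡ᵇ-reflects-≡ m n = fromEquivalence (≡ᵇ⇒≡ m n) (≡⇒≡ᵇ m n)

≡ᵇ-refl : ∀ n → (n ≡ᵇ n) ≡ true
≡ᵇ-refl n = reflects-true (≡ᵇ-reflects-≡ n n) refl

≡ᵇ-false : ∀ {m n} → m ≢ n → (m ≡ᵇ n) ≡ false
≡ᵇ-false {m} {n} = reflects-false (≡ᵇ-reflects-≡ m n)

-- On 0-based variables (` m is index m + 1): below d nothing moves, d + k moves
-- to d, and d, …, d + k − 1 move up by one.  By sw-rotate, rotate k d is
-- sw (d + 1) ∘ ⋯ ∘ sw (d + k).
rotateVar : ℕ → ℕ → ℕ → ℕ
rotateVar k d m =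
  if suc m ≤ᵇ d then m
  else if m ≡ᵇ d + k then d
  else if m <ᵇ d + k then suc m
  else m

rotate : ℕ → ℕ → Term → Term
rotate k d (` m)   = ` rotateVar k d m
rotate k d (a · b) = rotate k d a · rotate k d b
rotate k d (ƛ a)   = ƛ rotate k (suc d) a

rotateVar-< : ∀ {k d m} → m < d → rotateVar k d m ≡ m
rotateVar-< m<d rewrite ≤ᵇ-true m<d = refl

rotateVar-pivot : ∀ k d → rotateVar k d (d + k) ≡ d
rotateVar-pivot k d
  rewrite ≤ᵇ-false {suc (d + k)} {d} (s≤s (m≤m+n d k)) | ≡ᵇ-refl (d + k) = refl

rotateVar-shift : ∀ {k d m} → d ≤ m → m < d + k → rotateVar k d m ≡ suc m
rotateVar-shift d≤m m<d+k
  rewrite ≤ᵇ-false (s≤s d≤m) | ≡ᵇ-false (<⇒≢ m<d+k) | <ᵇ-true m<d+k = refl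

rotateVar-> : ∀ {k d m} → d + k < m → rotateVar k d m ≡ m
rotateVar-> {k} {d} d+k<m
  rewrite ≤ᵇ-false {suc _} {d} (s≤s (≤-trans (m≤m+n d k) (<⇒≤ d+k<m)))
        | ≡ᵇ-false (>⇒≢ d+k<m) | <ᵇ-false (<⇒≤ d+k<m) = refl

sw-var-lower : ∀ d → sw (suc d) (` d) ≡ ` suc d
sw-var-lower d rewrite ≡ᵇ-refl d = refl

sw-var-upper : ∀ d → sw (suc d) (` suc d) ≡ ` d
sw-var-upper d rewrite ≡ᵇ-false (1+n≢n {suc d}) | ≡ᵇ-refl d = refl

sw-var-other : ∀ {d m} → m ≢ d → m ≢ suc d → sw (suc d) (` m) ≡ ` m
sw-var-other m≢d m≢1+d
  rewrite ≡ᵇ-false m≢d | ≡ᵇ-false m≢1+d = refl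

sw-rotateVar : ∀ k d m → sw (suc d) (` rotateVar k (suc d) m) ≡ ` rotateVar (suc k) d m
sw-rotateVar k d m with <-cmp m d
... | tri< m<d _ _
  rewrite rotateVar-< {k} (m<n⇒m<1+n m<d) | rotateVar-< {suc k} m<d
  = sw-var-other (<⇒≢ m<d) (<⇒≢ (m<n⇒m<1+n m<d))
... | tri≈ _ refl _
  rewrite rotateVar-< {k} (n<1+n m) | rotateVar-shift {suc k} ≤-refl (m<m+n m z<s)
  = sw-var-lower m
... | tri> _ _ d<m with <-cmp m (suc d + k)
...   | tri< m<1+d+k _ _
  rewrite rotateVar-shift {k} {suc d} d<m m<1+d+k
        | rotateVar-shift {suc k} (<⇒≤ d<m) (subst (m <_) (sym (+-suc d k)) m<1+d+k)
  = sw-var-other (>⇒≢ (m<n⇒m<1+n d<m)) (>⇒≢ (s≤s d<m))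
...   | tri≈ _ refl _
  rewrite rotateVar-pivot k (suc d) | sym (+-suc d k) | rotateVar-pivot (suc k) d
  = sw-var-upper d
...   | tri> _ _ 1+d+k<m
  rewrite rotateVar-> {k} {suc d} 1+d+k<m
        | rotateVar-> {suc k} {d} (subst (_< m) (sym (+-suc d k)) 1+d+k<m)
  = sw-var-other (>⇒≢ d<m) (>⇒≢ (≤-<-trans (s≤s (m≤m+n d k)) 1+d+k<m))

sw-rotate : ∀ k d a → sw (suc d) (rotate k (suc d) a) ≡ rotate (suc k) d a
sw-rotate k d (` m)   = sw-rotateVar k d m
sw-rotate k d (a · b) = cong₂ _·_ (sw-rotate k d a) (sw-rotate k d b)
sw-rotate k d (ƛ a)   = cong ƛ_ (sw-rotate k (suc d) a)

rotate-identity : ∀ d a → rotate 0 d a ≡ a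
rotate-identity d (` m) with <-cmp m d
... | tri< m<d _ _ = cong `_ (rotateVar-< m<d)
... | tri≈ _ refl _ =
  cong `_ (subst (λ n → rotateVar 0 m n ≡ m) (+-identityʳ m) (rotateVar-pivot 0 m))
... | tri> _ _ d<m = cong `_ (rotateVar-> {0} {d} (subst (_< m) (sym (+-identityʳ d)) d<m))
rotate-identity d (a · b) = cong₂ _·_ (rotate-identity d a) (rotate-identity d b)
rotate-identity d (ƛ a)   = cong ƛ_ (rotate-identity (suc d) a)

U-identity : ∀ k a → U 1 k a ≡ a
U-identity k (` m) with suc m ≤ᵇ k
... | true  = refl
... | false = cong `_ (m+n∸n≡m m 1)
U-identity k (a · b) = cong₂ _·_ (U-identity k a) (U-identity k b)
U-identity k (ƛ a)   = cong ƛ_ (U-identity (suc k) a)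

inc-U : ∀ i k c → inc k (U (suc i) k c) ≡ U (suc (suc i)) k c
inc-U i k (` m) with m <? k
... | yes m<k rewrite ≤ᵇ-true m<k | ≤ᵇ-true m<k = refl
... | no m≮k
  rewrite ≤ᵇ-false {suc m} {k} (s≤s (≮⇒≥ m≮k)) | +-suc m (suc i) | +-suc m i
        | ≤ᵇ-false {suc (m + i)} {k} (s≤s (≤-trans (≮⇒≥ m≮k) (m≤m+n m i))) = refl
inc-U i k (a · b) = cong₂ _·_ (inc-U i k a) (inc-U i k b)
inc-U i k (ƛ a)   = cong ƛ_ (inc-U i (suc k) a)

open ≡-Reasoning

-- The induction is on a, not on the rotated term that subr consumes, so the
-- fuel bound never has to be transported along sw or rotate.
⟦←⟧≡subr-rotate : ∀ f a k c → size a ≤ f → a ⟦ suc k ← c ⟧ ≡ subr f (rotate k 0 a) (U (suc k) 0 c)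
⟦←⟧≡subr-rotate (suc f) (` m) k c _ with <-cmp m k
... | tri< m<k _ _ rewrite rotateVar-shift {k} {0} z≤n m<k | <ᵇ-true m<k = refl
... | tri≈ _ refl _ rewrite rotateVar-pivot m 0 | <ᵇ-false (≤-refl {m}) | ≡ᵇ-refl m = refl
⟦←⟧≡subr-rotate (suc f) (` suc m) k c _ | tri> _ _ k<1+m
  rewrite rotateVar-> {k} {0} k<1+m | <ᵇ-false (<⇒≤ k<1+m) | ≡ᵇ-false (>⇒≢ k<1+m) = refl
⟦←⟧≡subr-rotate (suc f) (a · b) k c (s≤s a·b≤f) =
  cong₂ _·_ (⟦←⟧≡subr-rotate f a k c (≤-trans (m≤m+n _ _) a·b≤f))
            (⟦←⟧≡subr-rotate f b k c (≤-trans (m≤n+m _ _) a·b≤f))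
⟦←⟧≡subr-rotate (suc f) (ƛ a) k c (s≤s a≤f) = cong ƛ_ (begin
  a ⟦ suc (suc k) ← c ⟧
    ≡⟨ ⟦←⟧≡subr-rotate f a (suc k) c a≤f ⟩
  subr f (rotate (suc k) 0 a) (U (suc (suc k)) 0 c)
    ≡⟨ cong₂ (subr f) (sw-rotate k 0 a) (inc-U k 0 c) ⟨
  subr f (sw 1 (rotate k 1 a)) (inc 0 (U (suc k) 0 c))
    ∎)

⟦1←⟧≡[] : ∀ a b → a ⟦ 1 ← b ⟧ ≡ a [ b ]
⟦1←⟧≡[] a b = begin
  a ⟦ 1 ← b ⟧
    ≡⟨ ⟦←⟧≡subr-rotate (size a) a 0 b ≤-refl ⟩
  subr (size a) (rotate 0 0 a) (U 1 0 b)
    ≡⟨ cong₂ (subr (size a)) (rotate-identity 0 a) (U-identity 0 b) ⟩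
  a [ b ]
    ∎

βdB⇒βr : ∀ {a b} → a →βdB b → a →βr b
βdB⇒βr (βdB C c d) = subst (λ t → plug C ((ƛ c) · d) →βr plug C t) (sym (⟦1←⟧≡[] c d)) (βr C c d)

βr⇒βdB : ∀ {a b} → a →βr b → a →βdB b
βr⇒βdB (βr C c d) = subst (λ t → plug C ((ƛ c) · d) →βdB plug C t) (⟦1←⟧≡[] c d) (βdB C c d)

corollary1 : (∀ (a b : Term) → a ⟦ 1 ← b ⟧ ≡ a [ b ])
           × (∀ (a b : Term) → (a →βdB b → a →βr b) × (a →βr b → a →βdB b))
corollary1 = ⟦1←⟧≡[] , λ _ _ → βdB⇒βr , βr⇒βdB
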